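{- Let $g$ be a good counter on a finite graph $G$, let $X,Y\subseteq V(G)$ be disjoint, and let $v\in V(G)\setminus(X\cup Y)$. Then $|g(X,Y)-g(X\cup\{v\},Y)|\le 1$ and $|g(X,Y)-g(X,Y\cup\{v\})|\le 1$.
   Context: All graphs are finite with no loops or parallel edges. For disjoint $X,Y\subseteq V(G)$, $f_G(X,Y)$ is the sum of $(-1)^{|A|}$ over all stable sets $A$ of $G$ with $X\subseteq A$ and $A\cap Y=\emptyset$. A counter on $G$ is either of the functions $f_G$ or $-f_G$. For a counter $g$ and $X\subseteq V(G)$ write $g(X)=g(X,\emptyset)$. A counter $g$ is good if for all disjoint $X,Y\subseteq V(G)$ with $X\cup Y\neq\emptyset$: (i) $|g(X,Y)|\le 1$; and (ii) $|g(X\cup\{u\},Y)-g(X\cup\{v\},Y)|\le 1$ for all $u,v\in V(G)\setminus(X\cup Y)$. -}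

module Defs where

open import Data.Nat using (ℕ; zero; suc; _≤_)
open import Data.Bool using (Bool; true; false; _∧_; _∨_; not; if_then_else_)
open import Data.Fin using (Fin)
open import Data.Vec using (Vec; []; _∷_)
open import Data.List using (List; []; _∷_; _++_; map; filter; foldr)
open import Data.Fin.Subset using (Subset; Side; inside; outside; _∈_; _∪_; ⁅_⁆; Nonempty)
open import Data.Integer using (ℤ; +_; -_; _+_; _-_; ∣_∣)
open import Data.Product using (_×_)
open import Relation.Nullary using (¬_)
open import Relation.Binary.PropositionalEquality using (_≡_)
open import Data.Vec.Functional using ()
open import Data.Fin.Subset using (_⊆_)

record Graph (n : ℕ) : Set where
  field
    adj    : Fin n → Fin n → Bool
    sym    : ∀ i j → adj i j ≡ adj j i
    irrefl : ∀ i → adj i i ≡ false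
open Graph public

allSubsets : (n : ℕ) → List (Subset n)
allSubsets zero = [] ∷ []
allSubsets (suc n) = map (outside ∷_) (allSubsets n) ++ map (inside ∷_) (allSubsets n)

memB : ∀ {n} → Fin n → Subset n → Bool
memB Fin.zero (inside ∷ p) = true
memB Fin.zero (outside ∷ p) = false
memB (Fin.suc i) (_ ∷ p) = memB i p

subB : ∀ {n} → Subset n → Subset n → Bool
subB [] [] = true
subB (inside ∷ a) (outside ∷ b) = false
subB (_ ∷ a) (_ ∷ b) = subB a b

disjB : ∀ {n} → Subset n → Subset n → Bool
disjB [] [] = true
disjB (inside ∷ a) (inside ∷ b) = false
disjB (_ ∷ a) (_ ∷ b) = disjB a b

allFinB : ∀ {n} → (Fin n → Bool) → Bool
allFinB {zero} p = true
allFinB {suc n} p = p Fin.zero ∧ allFinB (λ i → p (Fin.suc i))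

stableB : ∀ {n} → Graph n → Subset n → Bool
stableB G A = allFinB λ i → allFinB λ j →
  not (memB i A ∧ memB j A ∧ adj G i j)

sign : ∀ {n} → Subset n → ℤ
sign [] = + 1
sign (inside ∷ a) = - sign a
sign (outside ∷ a) = sign a

sumℤ : List ℤ → ℤ
sumℤ = foldr _+_ (+ 0)

fG : ∀ {n} → Graph n → Subset n → Subset n → ℤ
fG G X Y = sumℤ (map sign (filter (λ A → T? (stableB G A ∧ subB X A ∧ disjB A Y)) (allSubsets _)))
  where
  open import Data.Bool using (T?)

counter : ∀ {n} → Graph n → Bool → Subset n → Subset n → ℤ
counter G true X Y = fG G X Y
counter G false X Y = - fG G X Y

Disjoint : ∀ {n} → Subset n → Subset n → Set
Disjoint X Y = ∀ i → ¬ (i ∈ X × i ∈ Y)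

Good : ∀ {n} → (Subset n → Subset n → ℤ) → Set
Good {n} g = ∀ (X Y : Subset n) → Disjoint X Y → Nonempty (X ∪ Y) →
    (∣ g X Y ∣ ≤ 1)
  × (∀ (u v : Fin n) → ¬ (u ∈ X ∪ Y) → ¬ (v ∈ X ∪ Y) →
       ∣ g (X ∪ ⁅ u ⁆) Y - g (X ∪ ⁅ v ⁆) Y ∣ ≤ 1)

-- The proof rests on the deletion identity for stable-set counts: for any
-- vertex v, every stable set A with X ⊆ A and A ∩ Y = ∅ either contains v
-- or avoids it, so
--     f_G(X,Y) = f_G(X ∪ {v}, Y) + f_G(X, Y ∪ {v}),
-- and the same identity holds for -f_G, hence for every counter g.
-- Consequently g(X,Y) - g(X ∪ {v}, Y) = g(X, Y ∪ {v}) and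
-- g(X,Y) - g(X, Y ∪ {v}) = g(X ∪ {v}, Y); when v ∉ X ∪ Y both right-hand
-- sides are values of g on a disjoint pair with nonempty union, so condition
-- (i) of goodness bounds them by one.
module Submission where

open import Defs
open import Data.Nat using (ℕ; _≤_)
open import Data.Bool using (Bool; true; false; _∧_; not; T?)
open import Data.Bool.Properties using (∧-comm; ∧-identityʳ)
open import Data.Fin using (Fin; zero; suc)
open import Data.Fin.Subset using (Subset; _∈_; _∪_; ⁅_⁆; inside; outside)
open import Data.Fin.Subset.Properties using (x∈⁅x⁆; x∈⁅y⁆⇒x≡y; x∈p∪q⁺; x∈p∪q⁻; ∪-identityʳ)
open import Data.Vec using (_∷_)
open import Data.List using (List; []; _∷_; map; filter)
open import Data.Integer using (ℤ; _+_; -_; _-_; ∣_∣)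
open import Data.Integer.Properties using (neg-distrib-+)
open import Data.Integer.Tactic.RingSolver using (solve-∀)
open import Data.Product using (_×_; _,_; proj₁)
open import Data.Sum using (inj₁; inj₂)
open import Relation.Nullary using (¬_)
open import Relation.Binary.PropositionalEquality
  using (_≡_; refl; trans; cong; cong₂; subst; module ≡-Reasoning)
  renaming (sym to ≡-sym)

-- Signed sums over the members of a list passing a boolean test;
-- f_G G X Y is by definition sumIf (admissible G X Y) (allSubsets n).
sumIf : ∀ {n} → (Subset n → Bool) → List (Subset n) → ℤ
sumIf p L = sumℤ (map sign (filter (λ A → T? (p A)) L))

add-to-first : ∀ {s} (a b c : ℤ) → s ≡ b + c → a + s ≡ (a + b) + c
add-to-first a b c refl = +-rotate a b c
  where
  +-rotate : ∀ a b c → a + (b + c) ≡ (a + b) + c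
  +-rotate = solve-∀

add-to-second : ∀ {s} (a b c : ℤ) → s ≡ b + c → a + s ≡ b + (a + c)
add-to-second a b c refl = +-middle a b c
  where
  +-middle : ∀ a b c → a + (b + c) ≡ b + (a + c)
  +-middle = solve-∀

sumIf-split : ∀ {n} (p m : Subset n → Bool) L →
  sumIf p L ≡ sumIf (λ A → p A ∧ m A) L + sumIf (λ A → p A ∧ not (m A)) L
sumIf-split p m [] = refl
sumIf-split p m (A ∷ L) with p A | m A | sumIf-split p m L
... | true  | true  | ih =
  add-to-first (sign A) (sumIf (λ B → p B ∧ m B) L) (sumIf (λ B → p B ∧ not (m B)) L) ih
... | true  | false | ih =
  add-to-second (sign A) (sumIf (λ B → p B ∧ m B) L) (sumIf (λ B → p B ∧ not (m B)) L) ih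
... | false | true  | ih = ih
... | false | false | ih = ih

sumIf-cong : ∀ {n} {p q : Subset n → Bool} → (∀ A → p A ≡ q A) →
  ∀ L → sumIf p L ≡ sumIf q L
sumIf-cong p≗q [] = refl
sumIf-cong {q = q} p≗q (A ∷ L) rewrite p≗q A with q A
... | true  = cong (sign A +_) (sumIf-cong p≗q L)
... | false = sumIf-cong p≗q L

subB-∪⁅⁆ : ∀ {n} (v : Fin n) X A → subB (X ∪ ⁅ v ⁆) A ≡ subB X A ∧ memB v A
subB-∪⁅⁆ zero (inside  ∷ X) (inside  ∷ A) =
  trans (cong (λ Z → subB Z A) (∪-identityʳ X)) (≡-sym (∧-identityʳ _))
subB-∪⁅⁆ zero (inside  ∷ X) (outside ∷ A) = refl
subB-∪⁅⁆ zero (outside ∷ X) (inside  ∷ A) =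
  trans (cong (λ Z → subB Z A) (∪-identityʳ X)) (≡-sym (∧-identityʳ _))
subB-∪⁅⁆ zero (outside ∷ X) (outside ∷ A) = ≡-sym (∧-comm (subB X A) false)
subB-∪⁅⁆ (suc v) (inside  ∷ X) (inside  ∷ A) = subB-∪⁅⁆ v X A
subB-∪⁅⁆ (suc v) (inside  ∷ X) (outside ∷ A) = refl
subB-∪⁅⁆ (suc v) (outside ∷ X) (inside  ∷ A) = subB-∪⁅⁆ v X A
subB-∪⁅⁆ (suc v) (outside ∷ X) (outside ∷ A) = subB-∪⁅⁆ v X A

disjB-∪⁅⁆ : ∀ {n} (v : Fin n) Y A → disjB A (Y ∪ ⁅ v ⁆) ≡ disjB A Y ∧ not (memB v A)
disjB-∪⁅⁆ zero (inside  ∷ Y) (inside  ∷ A) = refl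
disjB-∪⁅⁆ zero (inside  ∷ Y) (outside ∷ A) =
  trans (cong (disjB A) (∪-identityʳ Y)) (≡-sym (∧-identityʳ _))
disjB-∪⁅⁆ zero (outside ∷ Y) (inside  ∷ A) = ≡-sym (∧-comm (disjB A Y) false)
disjB-∪⁅⁆ zero (outside ∷ Y) (outside ∷ A) =
  trans (cong (disjB A) (∪-identityʳ Y)) (≡-sym (∧-identityʳ _))
disjB-∪⁅⁆ (suc v) (inside  ∷ Y) (inside  ∷ A) = refl
disjB-∪⁅⁆ (suc v) (inside  ∷ Y) (outside ∷ A) = disjB-∪⁅⁆ v Y A
disjB-∪⁅⁆ (suc v) (outside ∷ Y) (inside  ∷ A) = disjB-∪⁅⁆ v Y A
disjB-∪⁅⁆ (suc v) (outside ∷ Y) (outside ∷ A) = disjB-∪⁅⁆ v Y A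

admissible : ∀ {n} → Graph n → Subset n → Subset n → Subset n → Bool
admissible G X Y A = stableB G A ∧ subB X A ∧ disjB A Y

∧-pull-middle : ∀ s x d m → s ∧ (x ∧ m) ∧ d ≡ (s ∧ x ∧ d) ∧ m
∧-pull-middle false x d m = refl
∧-pull-middle true false d m = refl
∧-pull-middle true true d m = ∧-comm m d

∧-pull-last : ∀ s x d m → s ∧ x ∧ (d ∧ m) ≡ (s ∧ x ∧ d) ∧ m
∧-pull-last false x d m = refl
∧-pull-last true false d m = refl
∧-pull-last true true d m = refl

admissible-∪ˡ : ∀ {n} (G : Graph n) X Y v A →
  admissible G (X ∪ ⁅ v ⁆) Y A ≡ admissible G X Y A ∧ memB v A
admissible-∪ˡ G X Y v A rewrite subB-∪⁅⁆ v X A =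
  ∧-pull-middle (stableB G A) (subB X A) (disjB A Y) (memB v A)

admissible-∪ʳ : ∀ {n} (G : Graph n) X Y v A →
  admissible G X (Y ∪ ⁅ v ⁆) A ≡ admissible G X Y A ∧ not (memB v A)
admissible-∪ʳ G X Y v A rewrite disjB-∪⁅⁆ v Y A =
  ∧-pull-last (stableB G A) (subB X A) (disjB A Y) (not (memB v A))

DeletionIdentity : ∀ {n} → (Subset n → Subset n → ℤ) → Set
DeletionIdentity {n} g =
  ∀ (X Y : Subset n) (v : Fin n) → g X Y ≡ g (X ∪ ⁅ v ⁆) Y + g X (Y ∪ ⁅ v ⁆)

fG-deletion : ∀ {n} (G : Graph n) → DeletionIdentity (fG G)
fG-deletion {n} G X Y v = begin
  sumIf (admissible G X Y) (allSubsets n)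
    ≡⟨ sumIf-split (admissible G X Y) (memB v) (allSubsets n) ⟩
  sumIf (λ A → admissible G X Y A ∧ memB v A) (allSubsets n)
    + sumIf (λ A → admissible G X Y A ∧ not (memB v A)) (allSubsets n)
    ≡⟨ ≡-sym (cong₂ _+_ (sumIf-cong (admissible-∪ˡ G X Y v) (allSubsets n))
                      (sumIf-cong (admissible-∪ʳ G X Y v) (allSubsets n))) ⟩
  fG G (X ∪ ⁅ v ⁆) Y + fG G X (Y ∪ ⁅ v ⁆) ∎
  where open ≡-Reasoning

counter-deletion : ∀ {n} (G : Graph n) b → DeletionIdentity (counter G b)
counter-deletion G true  = fG-deletion G
counter-deletion G false X Y v =
  trans (cong -_ (fG-deletion G X Y v))
        (neg-distrib-+ (fG G (X ∪ ⁅ v ⁆) Y) (fG G X (Y ∪ ⁅ v ⁆)))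

minus-summandˡ : ∀ {a} (b c : ℤ) → a ≡ b + c → a - b ≡ c
minus-summandˡ b c refl = +-minus-left b c
  where
  +-minus-left : ∀ b c → (b + c) - b ≡ c
  +-minus-left = solve-∀

minus-summandʳ : ∀ {a} (b c : ℤ) → a ≡ b + c → a - c ≡ b
minus-summandʳ b c refl = +-minus-right b c
  where
  +-minus-right : ∀ b c → (b + c) - c ≡ b
  +-minus-right = solve-∀

disjoint-∪⁅⁆ : ∀ {n} {X Y : Subset n} {v : Fin n} →
  Disjoint X Y → ¬ v ∈ X → Disjoint X (Y ∪ ⁅ v ⁆)
disjoint-∪⁅⁆ {Y = Y} {v} X#Y v∉X i (i∈X , i∈Y∪v) with x∈p∪q⁻ Y ⁅ v ⁆ i∈Y∪v
... | inj₁ i∈Y = X#Y i (i∈X , i∈Y)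
... | inj₂ i∈⁅v⁆ rewrite x∈⁅y⁆⇒x≡y v i∈⁅v⁆ = v∉X i∈X

disjoint-sym : ∀ {n} {X Y : Subset n} → Disjoint X Y → Disjoint Y X
disjoint-sym X#Y i (i∈Y , i∈X) = X#Y i (i∈X , i∈Y)

good-deletion-bound : ∀ {n} (g : Subset n → Subset n → ℤ) →
  Good g → DeletionIdentity g →
  ∀ (X Y : Subset n) → Disjoint X Y → (v : Fin n) → ¬ (v ∈ X ∪ Y) →
    (∣ g X Y - g (X ∪ ⁅ v ⁆) Y ∣ ≤ 1) × (∣ g X Y - g X (Y ∪ ⁅ v ⁆) ∣ ≤ 1)
good-deletion-bound g good deletion X Y X#Y v v∉X∪Y =
    bounded X (Y ∪ ⁅ v ⁆) X#Y+v v∈X∪Y+v (minus-summandˡ gX+vY gXY+v (deletion X Y v))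
  , bounded (X ∪ ⁅ v ⁆) Y X+v#Y v∈X+v∪Y (minus-summandʳ gX+vY gXY+v (deletion X Y v))
  where
  gX+vY gXY+v : ℤ
  gX+vY = g (X ∪ ⁅ v ⁆) Y
  gXY+v = g X (Y ∪ ⁅ v ⁆)
  bounded : ∀ {z} X′ Y′ → Disjoint X′ Y′ → v ∈ X′ ∪ Y′ → z ≡ g X′ Y′ → ∣ z ∣ ≤ 1
  bounded X′ Y′ X′#Y′ v∈X′∪Y′ z≡g =
    subst (λ w → ∣ w ∣ ≤ 1) (≡-sym z≡g) (proj₁ (good X′ Y′ X′#Y′ (v , v∈X′∪Y′)))
  v∉X : ¬ v ∈ X
  v∉X v∈X = v∉X∪Y (x∈p∪q⁺ (inj₁ v∈X))
  v∉Y : ¬ v ∈ Y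
  v∉Y v∈Y = v∉X∪Y (x∈p∪q⁺ (inj₂ v∈Y))
  X#Y+v : Disjoint X (Y ∪ ⁅ v ⁆)
  X#Y+v = disjoint-∪⁅⁆ X#Y v∉X
  X+v#Y : Disjoint (X ∪ ⁅ v ⁆) Y
  X+v#Y = disjoint-sym (disjoint-∪⁅⁆ (disjoint-sym X#Y) v∉Y)
  v∈X∪Y+v : v ∈ X ∪ (Y ∪ ⁅ v ⁆)
  v∈X∪Y+v = x∈p∪q⁺ (inj₂ (x∈p∪q⁺ (inj₂ (x∈⁅x⁆ v))))
  v∈X+v∪Y : v ∈ (X ∪ ⁅ v ⁆) ∪ Y
  v∈X+v∪Y = x∈p∪q⁺ (inj₁ (x∈p∪q⁺ (inj₂ (x∈⁅x⁆ v))))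

mainTheorem6 : ∀ {n : ℕ} (G : Graph n) (b : Bool) → Good (counter G b) →
    ∀ (X Y : Subset n) → Disjoint X Y → (v : Fin n) → ¬ (v ∈ X ∪ Y) →
      (∣ counter G b X Y - counter G b (X ∪ ⁅ v ⁆) Y ∣ ≤ 1)
      × (∣ counter G b X Y - counter G b X (Y ∪ ⁅ v ⁆) ∣ ≤ 1)
mainTheorem6 G b good = good-deletion-bound (counter G b) good (counter-deletion G b)
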